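{- Let $Q$ be the quiver of type $X_6$ with vertices $v_0,\dots,v_5$ and arrows $v_1\Rightarrow v_2$, $v_3\Rightarrow v_4$ (double arrows), $v_0\to v_1$, $v_2\to v_0$, $v_0\to v_3$, $v_4\to v_0$, and a single arrow $v_0\to v_5$ (so $v_5$ is a leaf). Then an integer vector $\boldsymbol b=(b_0,\dots,b_5)$ is admissible for $Q$ if and only if $b_5=-2b_0>0$ and $b_1=b_2=b_3=b_4=0$.
   Context: Quivers have no loops/2-cycles; $b_{ij}$ is the number of arrows $v_i\to v_j$ (negative if reversed); mutation $\mu_k$: $b'_{ij}=-b_{ij}$ if $k\in\{i,j\}$, else $b'_{ij}=b_{ij}+\mathrm{sgn}(b_{ik})[b_{ik}b_{kj}]_+$. For a quiver $Q$ on mutable vertices and an integer vector $\boldsymbol b$ indexed by them, add a frozen vertex $q$ with $b_i$ arrows from $v_i$ to $q$ (negative meaning arrows from $q$); mutations only at mutable vertices. $\boldsymbol b$ is admissible if $\boldsymbol b\neq0$ and the resulting quiver with frozen vertex has finite mutation class. -}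

module Defs where

open import Data.Nat using (ℕ; suc)
open import Data.Integer using (ℤ; +_; -[1+_]; -_; _+_; _*_; _<_; _≤?_; 0ℤ; 1ℤ; -1ℤ)
open import Data.Fin using (Fin; zero; suc; inject₁; _≟_)
open import Data.List using (List; [])
open import Data.List.Relation.Unary.Any using (Any)
open import Data.Product using (Σ; _×_)
open import Data.Maybe using (Maybe; just; nothing)
open import Relation.Nullary using (¬_; yes; no)
open import Relation.Binary.PropositionalEquality using (_≡_)

-- An (exchange) matrix on n vertices: b i j = number of arrows i → j
-- (negative if reversed).
Mat : ℕ → Set
Mat n = Fin n → Fin n → ℤ

[_]₊ : ℤ → ℤ
[ x ]₊ with 0ℤ ≤? x
... | yes _ = x
... | no  _ = 0ℤ

sgn : ℤ → ℤ
sgn (+ 0)       = 0ℤ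
sgn (+ (suc _)) = 1ℤ
sgn -[1+ _ ]  = -1ℤ

μ : ∀ {n} → Fin n → Mat n → Mat n
μ k B i j with i ≟ k | j ≟ k
... | yes _ | _     = - B i j
... | no _  | yes _ = - B i j
... | no _  | no _  = B i j + sgn (B i k) * [ B i k * B k j ]₊

μs : ∀ {n} → List (Fin n) → Mat n → Mat n
μs Data.List.[] B = B
μs (k Data.List.∷ ks) B = μs ks (μ k B)

_≐_ : ∀ {n} → Mat n → Mat n → Set
A ≐ B = ∀ i j → A i j ≡ B i j

-- We only need one
-- frozen vertex: mutable vertices are Fin m embedded via inject₁ into Fin (suc m).
FiniteMutationClass : ∀ {m} → Mat (suc m) → Set
FiniteMutationClass {m} B =
  Σ (List (Mat (suc m))) λ L →
    ∀ (ks : List (Fin m)) →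
      Any (λ C → μs (Data.List.map inject₁ ks) B ≐ C) L

-- Adding a frozen vertex q (= the last vertex) to Q with b i arrows v_i → q.
split : ∀ {m} → Fin (suc m) → Maybe (Fin m)
split {ℕ.zero} zero = nothing
split {suc m} zero = just zero
split {suc m} (suc i) with split {m} i
... | just j  = just (suc j)
... | nothing = nothing

withFrozen : ∀ {m} → Mat m → (Fin m → ℤ) → Mat (suc m)
withFrozen Q b i j with split i | split j
... | just i' | just j' = Q i' j'
... | just i' | nothing = b i'
... | nothing | just j' = - b j'
... | nothing | nothing = 0ℤ

Admissible : ∀ {m} → Mat m → (Fin m → ℤ) → Set
Admissible Q b = ¬ (∀ i → b i ≡ 0ℤ) × FiniteMutationClass (withFrozen Q b)

pattern v0 = zero
pattern v1 = suc zero
pattern v2 = suc (suc zero)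
pattern v3 = suc (suc (suc zero))
pattern v4 = suc (suc (suc (suc zero)))
pattern v5 = suc (suc (suc (suc (suc zero))))

X6 : Mat 6
X6 v1 v2 = + 2
X6 v2 v1 = - (+ 2)
X6 v3 v4 = + 2
X6 v4 v3 = - (+ 2)
X6 v0 v1 = 1ℤ
X6 v1 v0 = -1ℤ
X6 v2 v0 = 1ℤ
X6 v0 v2 = -1ℤ
X6 v0 v3 = 1ℤ
X6 v3 v0 = -1ℤ
X6 v4 v0 = 1ℤ
X6 v0 v4 = -1ℤ
X6 v0 v5 = 1ℤ
X6 v5 v0 = -1ℤ
X6 _ _ = 0ℤ

-- A double arrow a ⇒ b together with a third vertex c of weights u = b_ac, v = b_bc is a
-- Kronecker quiver with one extra vertex: mutating alternately at a and b preserves u + v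
-- and shifts the weights by u + v at every step, so in a mutation-finite quiver u + v = 0,
-- and one more mutation shows v ≥ 0.  Applied to v1 ⇒ v2 and v3 ⇒ v4 this gives
-- b₂ = −b₁ ≥ 0 and b₄ = −b₃ ≥ 0; applied to the double arrows v4 ⇒ v5 after μ₂μ₁μ₀ and
-- v2 ⇒ v5 after μ₄μ₃μ₀ it forces b₂ = b₄ = 0 and b₅ = −2b₀.
-- Conversely, for K = −b₀ > 0 the extended quiver is X₇ with the weights of its seventh
-- vertex multiplied by K.  Rescaling one row and column by a positive factor commutes with
-- mutation elsewhere, and up to relabelling the mutation class of X₇ consists of two
-- matrices, so every mutation has its entries in a fixed finite set.

module Submission where

open import Defs
open import Data.Fin using (Fin)
open import Data.Integer using (ℤ; _*_; -_; +_; _<_; 0ℤ)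
open import Data.Product using (_×_)
open import Function.Bundles using (_⇔_)
open import Relation.Binary.PropositionalEquality using (_≡_)

open import Data.Empty using (⊥; ⊥-elim)
open import Data.Fin using (zero; suc; inject₁; fromℕ; #_; _≟_)
open import Data.Fin.Properties using (all?; fromℕ≢inject₁)
open import Data.Integer
  using (+[1+_]; -[1+_]; _+_; _-_; _≤_; _≤?_; _<?_; ∣_∣; 1ℤ; -1ℤ; +≤+; +<+; -<-; nonNegative)
import Data.Integer.Properties as ℤ
open import Data.Integer.Tactic.RingSolver using (solve-∀)
open import Data.List using (List; []; _∷_; [_]; map; allFin; cartesianProductWith)
open import Data.List.Extrema.Nat using (max; v≤max⁺)
open import Data.List.Membership.DecPropositional ℤ._≟_ using (_∈?_)
open import Data.List.Membership.Propositional using (_∈_)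
open import Data.List.Membership.Propositional.Properties
  using (∈-allFin; ∈-map⁺; ∈-cartesianProductWith⁺)
open import Data.List.Relation.Unary.Any as Any using (Any; here; there)
open import Data.List.Relation.Unary.Any.Properties using (map⁺)
open import Data.Maybe using (just; nothing)
open import Data.Nat as ℕ using (ℕ)
import Data.Nat.Properties as ℕ
open import Data.Product using (Σ; _,_; proj₁; proj₂)
open import Data.Sum using (inj₁; inj₂)
open import Data.Vec using (Vec; []; _∷_; lookup; tabulate)
open import Data.Vec.Properties using (lookup∘tabulate)
open import Function using (_∘_; id)
open import Function.Bundles using (mk⇔)
open import Function.Definitions using (Injective)
open import Relation.Binary using (tri<; tri≈; tri>)
open import Relation.Binary.PropositionalEquality
  using (_≢_; refl; sym; trans; cong; cong₂; subst; subst₂; module ≡-Reasoning)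
open import Relation.Nullary using (¬_; yes; no)
open import Relation.Nullary.Decidable using (from-yes; _→-dec_)

0≤x⇒[x]₊≡x : ∀ {x} → 0ℤ ≤ x → [ x ]₊ ≡ x
0≤x⇒[x]₊≡x {x} 0≤x with 0ℤ ≤? x
... | yes _   = refl
... | no  0≰x = ⊥-elim (0≰x 0≤x)

x≤0⇒[x]₊≡0 : ∀ {x} → x ≤ 0ℤ → [ x ]₊ ≡ 0ℤ
x≤0⇒[x]₊≡0 {x} x≤0 with 0ℤ ≤? x
... | yes 0≤x = ℤ.≤-antisym x≤0 0≤x
... | no  _   = refl

0≤[x]₊ : ∀ x → 0ℤ ≤ [ x ]₊
0≤[x]₊ x with 0ℤ ≤? x
... | yes 0≤x = 0≤x
... | no  _   = ℤ.≤-refl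

[x]₊-[-x]₊≡x : ∀ x → [ x ]₊ - [ - x ]₊ ≡ x
[x]₊-[-x]₊≡x x with ℤ.≤-total 0ℤ x
... | inj₁ 0≤x =
  trans (cong₂ _-_ (0≤x⇒[x]₊≡x 0≤x) (x≤0⇒[x]₊≡0 (ℤ.neg-mono-≤ 0≤x))) (ℤ.+-identityʳ x)
... | inj₂ x≤0 = begin
  [ x ]₊ - [ - x ]₊  ≡⟨ cong₂ _-_ (x≤0⇒[x]₊≡0 x≤0) (0≤x⇒[x]₊≡x (ℤ.neg-mono-≤ x≤0)) ⟩
  0ℤ - - x           ≡⟨ ℤ.+-identityˡ (- - x) ⟩
  - - x              ≡⟨ ℤ.neg-involutive x ⟩
  x                  ∎
  where open ≡-Reasoning

*-nonneg : ∀ {x y} → 0ℤ ≤ x → 0ℤ ≤ y → 0ℤ ≤ x * y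
*-nonneg {+ m} {+ n} _ _ = subst (0ℤ ≤_) (ℤ.pos-* m n) (+≤+ ℕ.z≤n)

[d*x]₊≡d*[x]₊ : ∀ {d} → 0ℤ ≤ d → ∀ x → [ d * x ]₊ ≡ d * [ x ]₊
[d*x]₊≡d*[x]₊ {d} 0≤d x with ℤ.≤-total 0ℤ x
... | inj₁ 0≤x = trans (0≤x⇒[x]₊≡x (*-nonneg 0≤d 0≤x)) (cong (d *_) (sym (0≤x⇒[x]₊≡x 0≤x)))
... | inj₂ x≤0 = begin
  [ d * x ]₊   ≡⟨ x≤0⇒[x]₊≡0 dx≤0 ⟩
  0ℤ           ≡⟨ ℤ.*-zeroʳ d ⟨
  d * 0ℤ       ≡⟨ cong (d *_) (x≤0⇒[x]₊≡0 x≤0) ⟨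
  d * [ x ]₊   ∎
  where
    open ≡-Reasoning
    dx≤0 : d * x ≤ 0ℤ
    dx≤0 = subst (d * x ≤_) (ℤ.*-zeroʳ d) (ℤ.*-monoˡ-≤-nonNeg d {{nonNegative 0≤d}} x≤0)

sgn[x]*x≡∣x∣ : ∀ x → sgn x * x ≡ + ∣ x ∣
sgn[x]*x≡∣x∣ (+ ℕ.zero)  = refl
sgn[x]*x≡∣x∣ +[1+ n ]    = ℤ.*-identityˡ +[1+ n ]
sgn[x]*x≡∣x∣ -[1+ n ]    = ℤ.-1*i≡-i -[1+ n ]

sgn[-x]≡-sgn[x] : ∀ x → sgn (- x) ≡ - sgn x
sgn[-x]≡-sgn[x] (+ ℕ.zero) = refl
sgn[-x]≡-sgn[x] +[1+ n ]   = refl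
sgn[-x]≡-sgn[x] -[1+ n ]   = refl

sgn[d*x]≡sgn[x] : ∀ {d} → 0ℤ < d → ∀ x → sgn (d * x) ≡ sgn x
sgn[d*x]≡sgn[x] {+[1+ n ]} _ (+ ℕ.zero) = cong sgn (ℤ.*-zeroʳ +[1+ n ])
sgn[d*x]≡sgn[x] {+[1+ n ]} _ +[1+ m ]   = refl
sgn[d*x]≡sgn[x] {+[1+ n ]} _ -[1+ m ]   = refl
sgn[d*x]≡sgn[x] {+ ℕ.zero} (+<+ ())

x<y<0⇒∣y∣<∣x∣ : ∀ {x y} → x < y → y < 0ℤ → ∣ y ∣ ℕ.< ∣ x ∣
x<y<0⇒∣y∣<∣x∣ { -[1+ _ ]} { -[1+ _ ]} (-<- y<x) _ = ℕ.s≤s y<x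
x<y<0⇒∣y∣<∣x∣ {+ _}      {+ _}      _ (+<+ ())
x<y<0⇒∣y∣<∣x∣ { -[1+ _ ]} {+ _}      _ (+<+ ())

nonneg-sum-zero : ∀ {x y} → 0ℤ ≤ x → 0ℤ ≤ y → x + y ≡ 0ℤ → x ≡ 0ℤ × y ≡ 0ℤ
nonneg-sum-zero {x} {y} 0≤x 0≤y x+y≡0 =
  ℤ.≤-antisym (subst (x ≤_) x+y≡0 x≤x+y) 0≤x , ℤ.≤-antisym (subst (y ≤_) x+y≡0 y≤x+y) 0≤y
  where
    x≤x+y : x ≤ x + y
    x≤x+y = subst (_≤ x + y) (ℤ.+-identityʳ x) (ℤ.+-monoʳ-≤ x 0≤y)
    y≤x+y : y ≤ x + y
    y≤x+y = subst (_≤ x + y) (ℤ.+-identityˡ y) (ℤ.+-monoˡ-≤ y 0≤x)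

x≡-y⇒x≡0⇒y≡0 : ∀ {x y} → x ≡ - y → x ≡ 0ℤ → y ≡ 0ℤ
x≡-y⇒x≡0⇒y≡0 {x} {y} x≡-y x≡0 = trans (sym (ℤ.neg-involutive y)) (cong -_ (trans (sym x≡-y) x≡0))

module _ {n : ℕ} where

  μ-pivot-row : ∀ k (B : Mat n) j → μ k B k j ≡ - B k j
  μ-pivot-row k B j with k ≟ k
  ... | yes _  = refl
  ... | no k≢k = ⊥-elim (k≢k refl)

  μ-pivot-col : ∀ k (B : Mat n) i → μ k B i k ≡ - B i k
  μ-pivot-col k B i with i ≟ k | k ≟ k
  ... | yes _ | _      = refl
  ... | no _  | yes _  = refl
  ... | no _  | no k≢k = ⊥-elim (k≢k refl)

  μ-off-pivot : ∀ {k i j} (B : Mat n) → i ≢ k → j ≢ k →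
                μ k B i j ≡ B i j + sgn (B i k) * [ B i k * B k j ]₊
  μ-off-pivot {k} {i} {j} B i≢k j≢k with i ≟ k | j ≟ k
  ... | yes i≡k | _       = ⊥-elim (i≢k i≡k)
  ... | no _    | yes j≡k = ⊥-elim (j≢k j≡k)
  ... | no _    | no _    = refl

  μ-off-pivot-unchanged : ∀ {k i j} (B : Mat n) → i ≢ k → j ≢ k →
                          B i k * B k j ≤ 0ℤ → μ k B i j ≡ B i j
  μ-off-pivot-unchanged {k} {i} {j} B i≢k j≢k p≤0 = begin
    μ k B i j                                 ≡⟨ μ-off-pivot B i≢k j≢k ⟩
    B i j + sgn (B i k) * [ B i k * B k j ]₊  ≡⟨ cong (λ x → B i j + sgn (B i k) * x) (x≤0⇒[x]₊≡0 p≤0) ⟩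
    B i j + sgn (B i k) * 0ℤ                  ≡⟨ cong (λ x → B i j + x) (ℤ.*-zeroʳ (sgn (B i k))) ⟩
    B i j + 0ℤ                                ≡⟨ ℤ.+-identityʳ (B i j) ⟩
    B i j                                     ∎
    where open ≡-Reasoning

  μ-off-pivot-composite : ∀ {k i j} (B : Mat n) → i ≢ k → j ≢ k →
                          0ℤ ≤ B i k * B k j → μ k B i j ≡ B i j + + ∣ B i k ∣ * B k j
  μ-off-pivot-composite {k} {i} {j} B i≢k j≢k 0≤p = begin
    μ k B i j                                 ≡⟨ μ-off-pivot B i≢k j≢k ⟩
    B i j + sgn (B i k) * [ B i k * B k j ]₊  ≡⟨ cong (λ x → B i j + sgn (B i k) * x) (0≤x⇒[x]₊≡x 0≤p) ⟩
    B i j + sgn (B i k) * (B i k * B k j)     ≡⟨ cong (λ x → B i j + x) (ℤ.*-assoc (sgn (B i k)) _ _) ⟨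
    B i j + sgn (B i k) * B i k * B k j       ≡⟨ cong (λ x → B i j + x * B k j) (sgn[x]*x≡∣x∣ (B i k)) ⟩
    B i j + + ∣ B i k ∣ * B k j               ∎
    where open ≡-Reasoning

  μ-off-pivot-out : ∀ {k i j} (B : Mat n) → i ≢ k → j ≢ k → B i k ≡ 1ℤ →
                    μ k B i j ≡ B i j + [ B k j ]₊
  μ-off-pivot-out {k} {i} {j} B i≢k j≢k Bik≡1 = begin
    μ k B i j                                 ≡⟨ μ-off-pivot B i≢k j≢k ⟩
    B i j + sgn (B i k) * [ B i k * B k j ]₊  ≡⟨ cong (λ x → B i j + sgn x * [ x * B k j ]₊) Bik≡1 ⟩
    B i j + 1ℤ * [ 1ℤ * B k j ]₊              ≡⟨ cong (λ x → B i j + x) (ℤ.*-identityˡ _) ⟩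
    B i j + [ 1ℤ * B k j ]₊                   ≡⟨ cong (λ x → B i j + [ x ]₊) (ℤ.*-identityˡ (B k j)) ⟩
    B i j + [ B k j ]₊                        ∎
    where open ≡-Reasoning

  μ-off-pivot-in : ∀ {k i j} (B : Mat n) → i ≢ k → j ≢ k → B i k ≡ -1ℤ →
                   μ k B i j ≡ B i j - [ - B k j ]₊
  μ-off-pivot-in {k} {i} {j} B i≢k j≢k Bik≡-1 = begin
    μ k B i j                                 ≡⟨ μ-off-pivot B i≢k j≢k ⟩
    B i j + sgn (B i k) * [ B i k * B k j ]₊  ≡⟨ cong (λ x → B i j + sgn x * [ x * B k j ]₊) Bik≡-1 ⟩
    B i j + -1ℤ * [ -1ℤ * B k j ]₊            ≡⟨ cong (λ x → B i j + x) (ℤ.-1*i≡-i _) ⟩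
    B i j - [ -1ℤ * B k j ]₊                  ≡⟨ cong (λ x → B i j - [ x ]₊) (ℤ.-1*i≡-i (B k j)) ⟩
    B i j - [ - B k j ]₊                      ∎
    where open ≡-Reasoning

  ≐-trans : ∀ {A B C : Mat n} → A ≐ B → B ≐ C → A ≐ C
  ≐-trans A≐B B≐C i j = trans (A≐B i j) (B≐C i j)

  μ-cong : ∀ k {A B : Mat n} → A ≐ B → μ k A ≐ μ k B
  μ-cong k {A} {B} A≐B i j with i ≟ k | j ≟ k
  ... | yes _ | _     = cong -_ (A≐B i j)
  ... | no _  | yes _ = cong -_ (A≐B i j)
  ... | no _  | no _  rewrite A≐B i j | A≐B i k | A≐B k j = refl

  μs-cong : ∀ ks {A B : Mat n} → A ≐ B → μs ks A ≐ μs ks B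
  μs-cong []       A≐B = A≐B
  μs-cong (k ∷ ks) A≐B = μs-cong ks (μ-cong k A≐B)

  negateᴹ : Mat n → Mat n
  negateᴹ B i j = - B i j

  μ-negate : ∀ k (B : Mat n) → μ k (negateᴹ B) ≐ negateᴹ (μ k B)
  μ-negate k B i j with i ≟ k | j ≟ k
  ... | yes _ | _     = refl
  ... | no _  | yes _ = refl
  ... | no _  | no _  = begin
    - B i j + sgn (- B i k) * [ - B i k * - B k j ]₊
      ≡⟨ cong₂ (λ s p → - B i j + s * [ p ]₊) (sgn[-x]≡-sgn[x] (B i k)) (neg-*-neg (B i k) (B k j)) ⟩
    - B i j + - sgn (B i k) * [ B i k * B k j ]₊
      ≡⟨ neg-distrib (B i j) (sgn (B i k)) _ ⟩
    - (B i j + sgn (B i k) * [ B i k * B k j ]₊) ∎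
    where
      open ≡-Reasoning
      neg-*-neg : ∀ x y → - x * - y ≡ x * y
      neg-*-neg = solve-∀
      neg-distrib : ∀ x s p → - x + - s * p ≡ - (x + s * p)
      neg-distrib = solve-∀

  μs-negate : ∀ ks (B : Mat n) → μs ks (negateᴹ B) ≐ negateᴹ (μs ks B)
  μs-negate []       B i j = refl
  μs-negate (k ∷ ks) B i j = trans (μs-cong ks (μ-negate k B) i j) (μs-negate ks (μ k B) i j)

MutationBounded : ∀ {m} → ℕ → Mat (ℕ.suc m) → Set
MutationBounded {m} N B = ∀ (ks : List (Fin m)) i j → ∣ μs (map inject₁ ks) B i j ∣ ℕ.≤ N

MutationBounded-μs : ∀ {m N} {B : Mat (ℕ.suc m)} → MutationBounded N B →
                     ∀ ks → MutationBounded N (μs (map inject₁ ks) B)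
MutationBounded-μs bounded []       = bounded
MutationBounded-μs bounded (k ∷ ks) = MutationBounded-μs (λ ks′ → bounded (k ∷ ks′)) ks

MutationBounded-negate : ∀ {m N} {B : Mat (ℕ.suc m)} → MutationBounded N B → MutationBounded N (negateᴹ B)
MutationBounded-negate {N = N} {B} bounded ks i j = subst (ℕ._≤ N) ∣entry∣-invariant (bounded ks i j)
  where
    ∣entry∣-invariant : ∣ μs (map inject₁ ks) B i j ∣ ≡ ∣ μs (map inject₁ ks) (negateᴹ B) i j ∣
    ∣entry∣-invariant = trans (sym (ℤ.∣-i∣≡∣i∣ (μs (map inject₁ ks) B i j)))
                              (cong ∣_∣ (sym (μs-negate (map inject₁ ks) B i j)))

entries : ∀ {n} → Mat n → List ℤ
entries {n} C = cartesianProductWith C (allFin n) (allFin n)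

maxEntry : ∀ {n} → Mat n → ℕ
maxEntry C = max 0 (map ∣_∣ (entries C))

∣entry∣≤maxEntry : ∀ {n} {M : Mat n} C → M ≐ C → ∀ i j → ∣ M i j ∣ ℕ.≤ maxEntry C
∣entry∣≤maxEntry C M≐C i j = subst (ℕ._≤ maxEntry C) (cong ∣_∣ (sym (M≐C i j)))
  (v≤max⁺ 0 _ (inj₂ (Any.map ℕ.≤-reflexive (∈-map⁺ ∣_∣ (∈-cartesianProductWith⁺ C (∈-allFin i) (∈-allFin j))))))

finite⇒bounded : ∀ {m} {B : Mat (ℕ.suc m)} → FiniteMutationClass B → Σ ℕ λ N → MutationBounded N B
finite⇒bounded (L , every) = max 0 (map maxEntry L) , λ ks i j →
  v≤max⁺ 0 _ (inj₂ (map⁺ (Any.map (λ {C} M≐C → ∣entry∣≤maxEntry C M≐C i j) (every ks))))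

-- Double arrows in bounded mutation classes

record Kronecker {m} (N : ℕ) (B : Mat (ℕ.suc m)) (a b : Fin m) (c : Fin (ℕ.suc m)) : Set where
  field
    bounded : MutationBounded N B
    a⇒b     : B (inject₁ a) (inject₁ b) ≡ + 2
    b⇐a     : B (inject₁ b) (inject₁ a) ≡ - + 2
    c≢a     : c ≢ inject₁ a
    c≢b     : c ≢ inject₁ b

  b≢a : inject₁ b ≢ inject₁ a
  b≢a b≡a with () ← trans (sym (subst (λ x → B (inject₁ a) x ≡ + 2) b≡a a⇒b))
                           (subst (λ x → B x (inject₁ a) ≡ - + 2) b≡a b⇐a)

module _ {m N : ℕ} {c : Fin (ℕ.suc m)} where
  private
    ⇑ : Fin m → Fin (ℕ.suc m)
    ⇑ = inject₁

  μ-source : ∀ {B a b} → Kronecker N B a b c → Kronecker N (μ (⇑ a) B) b a c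
  μ-source {B} {a} {b} K = record
    { bounded = λ ks → bounded (a ∷ ks)
    ; a⇒b     = trans (μ-pivot-col (⇑ a) B (⇑ b)) (cong -_ b⇐a)
    ; b⇐a     = trans (μ-pivot-row (⇑ a) B (⇑ b)) (cong -_ a⇒b)
    ; c≢a     = c≢b
    ; c≢b     = c≢a
    }
    where open Kronecker K

  negate-kronecker : ∀ {B a b} → Kronecker N B a b c → Kronecker N (negateᴹ B) b a c
  negate-kronecker K = record
    { bounded = MutationBounded-negate bounded
    ; a⇒b     = cong -_ b⇐a
    ; b⇐a     = cong -_ a⇒b
    ; c≢a     = c≢b
    ; c≢b     = c≢a
    }
    where open Kronecker K

  target-after-μ-source-nonpos : ∀ {B a b} → Kronecker N B a b c → B (⇑ a) c ≤ 0ℤ →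
                                 μ (⇑ a) B (⇑ b) c ≡ B (⇑ b) c + + 2 * B (⇑ a) c
  target-after-μ-source-nonpos {B} {a} {b} K u≤0 =
    trans (μ-off-pivot-composite B b≢a c≢a 0≤p) (cong (λ x → B (⇑ b) c + + ∣ x ∣ * B (⇑ a) c) b⇐a)
    where
      open Kronecker K
      0≤p : 0ℤ ≤ B (⇑ b) (⇑ a) * B (⇑ a) c
      0≤p = subst (λ x → 0ℤ ≤ x * B (⇑ a) c) (sym b⇐a) (ℤ.*-monoˡ-≤-nonPos -[1+ 1 ] u≤0)

  target-after-μ-source-nonneg : ∀ {B a b} → Kronecker N B a b c → 0ℤ ≤ B (⇑ a) c →
                                 μ (⇑ a) B (⇑ b) c ≡ B (⇑ b) c
  target-after-μ-source-nonneg {B} {a} {b} K 0≤u = μ-off-pivot-unchanged B b≢a c≢a p≤0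
    where
      open Kronecker K
      p≤0 : B (⇑ b) (⇑ a) * B (⇑ a) c ≤ 0ℤ
      p≤0 = subst (λ x → x * B (⇑ a) c ≤ 0ℤ) (sym b⇐a) (ℤ.*-monoˡ-≤-nonPos -[1+ 1 ] 0≤u)

  -- With u = B a c < 0 and s = u + v < 0, the mutation at a gives the weights
  -- (u + s, −u) to (b, a): the sum stays s and the source weight drops by |s| ≥ 1.
  descent : ∀ n {B a b} → Kronecker N B a b c → B (⇑ a) c < 0ℤ → B (⇑ a) c + B (⇑ b) c < 0ℤ →
            ∣ B (⇑ a) c ∣ ℕ.+ n ℕ.≤ N
  descent ℕ.zero    {a = a} K _ _ =
    subst (ℕ._≤ N) (sym (ℕ.+-identityʳ _)) (Kronecker.bounded K [] (⇑ a) c)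
  descent (ℕ.suc n) {B} {a} {b} K u<0 s<0 = begin
    ∣ u ∣ ℕ.+ ℕ.suc n  ≡⟨ ℕ.+-suc ∣ u ∣ n ⟩
    ℕ.suc ∣ u ∣ ℕ.+ n  ≤⟨ ℕ.+-monoˡ-≤ n (x<y<0⇒∣y∣<∣x∣ u′<u u<0) ⟩
    ∣ u′ ∣ ℕ.+ n       ≤⟨ descent n (μ-source K) (ℤ.<-trans u′<u u<0) s′<0 ⟩
    N                  ∎
    where
      open ℕ.≤-Reasoning
      u v u′ : ℤ
      u  = B (⇑ a) c
      v  = B (⇑ b) c
      u′ = μ (⇑ a) B (⇑ b) c
      u′≡u+s : u′ ≡ u + (u + v)
      u′≡u+s = trans (target-after-μ-source-nonpos K (ℤ.<⇒≤ u<0)) (regroup u v)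
        where regroup : ∀ u v → v + + 2 * u ≡ u + (u + v)
              regroup = solve-∀
      u′<u : u′ < u
      u′<u = subst₂ _<_ (sym u′≡u+s) (ℤ.+-identityʳ u) (ℤ.+-monoʳ-< u s<0)
      s′<0 : u′ + μ (⇑ a) B (⇑ a) c < 0ℤ
      s′<0 = subst (_< 0ℤ) (sym (trans (cong₂ _+_ u′≡u+s (μ-pivot-row (⇑ a) B c)) (cancel u v))) s<0
        where cancel : ∀ u v → u + (u + v) + - u ≡ u + v
              cancel = solve-∀

  descent-absurd : ∀ {B a b} → Kronecker N B a b c →
                   B (⇑ a) c < 0ℤ → B (⇑ a) c + B (⇑ b) c < 0ℤ → ⊥
  descent-absurd K u<0 s<0 =
    ℕ.n≮n N (ℕ.≤-trans (ℕ.m≤n+m (ℕ.suc N) _) (descent (ℕ.suc N) K u<0 s<0))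

  no-negative-sum : ∀ {B a b} → Kronecker N B a b c → ¬ (B (⇑ a) c + B (⇑ b) c < 0ℤ)
  no-negative-sum {B} {a} {b} K s<0 with B (⇑ a) c <? 0ℤ
  ... | yes u<0 = descent-absurd K u<0 s<0
  ... | no  u≮0 = descent-absurd (μ-source K) u′<0 s′<0
    where
      u v : ℤ
      u = B (⇑ a) c
      v = B (⇑ b) c
      0≤u : 0ℤ ≤ u
      0≤u = ℤ.≮⇒≥ u≮0
      u′≡v : μ (⇑ a) B (⇑ b) c ≡ v
      u′≡v = target-after-μ-source-nonneg K 0≤u
      v<0 : v < 0ℤ
      v<0 = ℤ.≤-<-trans (subst (_≤ u + v) (ℤ.+-identityˡ v) (ℤ.+-monoˡ-≤ v 0≤u)) s<0
      u′<0 : μ (⇑ a) B (⇑ b) c < 0ℤ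
      u′<0 = subst (_< 0ℤ) (sym u′≡v) v<0
      s′<0 : μ (⇑ a) B (⇑ b) c + μ (⇑ a) B (⇑ a) c < 0ℤ
      s′<0 = subst (_< 0ℤ) (sym (cong₂ _+_ u′≡v (μ-pivot-row (⇑ a) B c)))
                   (ℤ.+-mono-<-≤ v<0 (ℤ.neg-mono-≤ 0≤u))

  -- Negating B reverses the double arrow and turns the weights (u, v) into (−v, −u).
  no-positive-sum : ∀ {B a b} → Kronecker N B a b c → ¬ (0ℤ < B (⇑ a) c + B (⇑ b) c)
  no-positive-sum {B} {a} {b} K 0<s = no-negative-sum (negate-kronecker K)
    (subst (_< 0ℤ) (trans (ℤ.neg-distrib-+ u v) (ℤ.+-comm (- u) (- v))) (ℤ.neg-mono-< 0<s))
    where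
      u v : ℤ
      u = B (⇑ a) c
      v = B (⇑ b) c

  kronecker-weights : ∀ {B a b} → Kronecker N B a b c → B (⇑ b) c ≡ - B (⇑ a) c × 0ℤ ≤ B (⇑ b) c
  kronecker-weights {B} {a} {b} K = v≡-u , ℤ.≮⇒≥ v≮0
    where
      u v : ℤ
      u = B (⇑ a) c
      v = B (⇑ b) c
      s≡0 : u + v ≡ 0ℤ
      s≡0 with ℤ.<-cmp (u + v) 0ℤ
      ... | tri< s<0 _ _ = ⊥-elim (no-negative-sum K s<0)
      ... | tri≈ _ s≡0 _ = s≡0
      ... | tri> _ _ 0<s = ⊥-elim (no-positive-sum K 0<s)
      v≡-u : v ≡ - u
      v≡-u = trans (regroup u v) (trans (cong (_+ - u) s≡0) (ℤ.+-identityˡ (- u)))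
        where regroup : ∀ u v → v ≡ (u + v) + - u
              regroup = solve-∀
      v≮0 : ¬ (v < 0ℤ)
      v≮0 v<0 = no-negative-sum (μ-source K) (subst (_< 0ℤ) (sym s′≡v+v) (ℤ.+-mono-< v<0 v<0))
        where
          0≤u : 0ℤ ≤ u
          0≤u = subst (0ℤ ≤_) (trans (cong -_ v≡-u) (ℤ.neg-involutive u)) (ℤ.neg-mono-≤ (ℤ.<⇒≤ v<0))
          s′≡v+v : μ (⇑ a) B (⇑ b) c + μ (⇑ a) B (⇑ a) c ≡ v + v
          s′≡v+v = cong₂ _+_ (target-after-μ-source-nonneg K 0≤u)
                             (trans (μ-pivot-row (⇑ a) B c) (sym v≡-u))

frozen-kronecker-weights : ∀ {m N} {B : Mat (ℕ.suc m)} (a b : Fin m) → MutationBounded N B →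
                   B (inject₁ a) (inject₁ b) ≡ + 2 → B (inject₁ b) (inject₁ a) ≡ - + 2 →
                   B (inject₁ b) (fromℕ m) ≡ - B (inject₁ a) (fromℕ m) × 0ℤ ≤ B (inject₁ b) (fromℕ m)
frozen-kronecker-weights a b bounded a⇒b b⇐a = kronecker-weights (record
  { bounded = bounded ; a⇒b = a⇒b ; b⇐a = b⇐a ; c≢a = fromℕ≢inject₁ ; c≢b = fromℕ≢inject₁ })

PositiveX7Multiple : (Fin 6 → ℤ) → Set
PositiveX7Multiple b =
  (b v5 ≡ - (+ 2 * b v0)) × (0ℤ < b v5) × (b v1 ≡ 0ℤ) × (b v2 ≡ 0ℤ) × (b v3 ≡ 0ℤ) × (b v4 ≡ 0ℤ)

q : Fin 7
q = fromℕ 6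

module FrozenColumn₀₁₂ (b : Fin 6 → ℤ) (b₂≡-b₁ : b v2 ≡ - b v1) (0≤b₂ : 0ℤ ≤ b v2) where
  open ≡-Reasoning

  B₀ B₁ B₂ B₃ : Mat 7
  B₀ = withFrozen X6 b
  B₁ = μ v0 B₀
  B₂ = μ v1 B₁
  B₃ = μ v2 B₂

  B₁-v1 : B₁ v1 q ≡ b v1 - [ - b v0 ]₊
  B₁-v1 = μ-off-pivot-in {k = v0} {v1} {q} B₀ (λ ()) (λ ()) refl

  B₁-v2 : B₁ v2 q ≡ b v2 + [ b v0 ]₊
  B₁-v2 = μ-off-pivot-out {k = v0} {v2} {q} B₀ (λ ()) (λ ()) refl

  B₁-v4 : B₁ v4 q ≡ b v4 + [ b v0 ]₊
  B₁-v4 = μ-off-pivot-out {k = v0} {v4} {q} B₀ (λ ()) (λ ()) refl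

  B₁-v5 : B₁ v5 q ≡ b v5 - [ - b v0 ]₊
  B₁-v5 = μ-off-pivot-in {k = v0} {v5} {q} B₀ (λ ()) (λ ()) refl

  b₁≤0 : b v1 ≤ 0ℤ
  b₁≤0 = ℤ.neg-cancel-≤ (subst (0ℤ ≤_) b₂≡-b₁ 0≤b₂)

  B₁-v1≤0 : B₁ v1 q ≤ 0ℤ
  B₁-v1≤0 = subst (_≤ 0ℤ) (sym B₁-v1) (ℤ.+-mono-≤ b₁≤0 (ℤ.neg-mono-≤ (0≤[x]₊ (- b v0))))

  B₂-v2 : B₂ v2 q ≡ b v0
  B₂-v2 = begin
    B₂ v2 q                                      ≡⟨ μ-off-pivot-in {k = v1} {v2} {q} B₁ (λ ()) (λ ()) refl ⟩
    B₁ v2 q - [ - B₁ v1 q ]₊                     ≡⟨ cong (λ y → B₁ v2 q - y) (0≤x⇒[x]₊≡x (ℤ.neg-mono-≤ B₁-v1≤0)) ⟩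
    B₁ v2 q - - B₁ v1 q                          ≡⟨ cong₂ (λ x y → x - - y) B₁-v2 B₁-v1 ⟩
    b v2 + [ b v0 ]₊ - - (b v1 - [ - b v0 ]₊)    ≡⟨ cong (λ x → x + [ b v0 ]₊ - - (b v1 - [ - b v0 ]₊)) b₂≡-b₁ ⟩
    - b v1 + [ b v0 ]₊ - - (b v1 - [ - b v0 ]₊)  ≡⟨ cancel (b v1) [ b v0 ]₊ [ - b v0 ]₊ ⟩
    [ b v0 ]₊ - [ - b v0 ]₊                      ≡⟨ [x]₊-[-x]₊≡x (b v0) ⟩
    b v0                                         ∎
    where cancel : ∀ x p n → - x + p - - (x - n) ≡ p - n
          cancel = solve-∀

  B₂-v4 : B₂ v4 q ≡ B₁ v4 q
  B₂-v4 = μ-off-pivot-unchanged {k = v1} {v4} {q} B₁ (λ ()) (λ ()) (ℤ.*-monoˡ-≤-nonNeg 1ℤ B₁-v1≤0)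

  B₂-v5 : B₂ v5 q ≡ B₁ v5 q
  B₂-v5 = μ-off-pivot-unchanged {k = v1} {v5} {q} B₁ (λ ()) (λ ()) ℤ.≤-refl

  B₃-v4 : B₃ v4 q ≡ b v4 + [ b v0 ]₊ + [ b v0 ]₊
  B₃-v4 = begin
    B₃ v4 q                       ≡⟨ μ-off-pivot-out {k = v2} {v4} {q} B₂ (λ ()) (λ ()) refl ⟩
    B₂ v4 q + [ B₂ v2 q ]₊        ≡⟨ cong₂ (λ x y → x + [ y ]₊) (trans B₂-v4 B₁-v4) B₂-v2 ⟩
    b v4 + [ b v0 ]₊ + [ b v0 ]₊  ∎

  B₃-v5 : B₃ v5 q ≡ b v5 - [ - b v0 ]₊ - [ - b v0 ]₊
  B₃-v5 = begin
    B₃ v5 q                           ≡⟨ μ-off-pivot-in {k = v2} {v5} {q} B₂ (λ ()) (λ ()) refl ⟩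
    B₂ v5 q - [ - B₂ v2 q ]₊          ≡⟨ cong₂ (λ x y → x - [ - y ]₊) (trans B₂-v5 B₁-v5) B₂-v2 ⟩
    b v5 - [ - b v0 ]₊ - [ - b v0 ]₊  ∎

  v4⇒v5-constraint : 0ℤ ≤ b v4 → B₃ v5 q ≡ - B₃ v4 q → 0ℤ ≤ B₃ v5 q →
                    b v4 ≡ 0ℤ × b v5 ≡ - (+ 2 * b v0) × b v0 ≤ 0ℤ
  v4⇒v5-constraint 0≤b₄ w₅≡-w₄ 0≤w₅ = b₄≡0 , b₅≡-2b₀ , b₀≤0
    where
      p n : ℤ
      p = [ b v0 ]₊
      n = [ - b v0 ]₊
      0≤p : 0ℤ ≤ p
      0≤p = 0≤[x]₊ (b v0)
      w₄≡0 : b v4 + p + p ≡ 0ℤ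
      w₄≡0 = ℤ.≤-antisym (subst (_≤ 0ℤ) B₃-v4 (ℤ.neg-cancel-≤ (subst (0ℤ ≤_) w₅≡-w₄ 0≤w₅)))
                         (ℤ.+-mono-≤ (ℤ.+-mono-≤ 0≤b₄ 0≤p) 0≤p)
      b₄+p≡0 : b v4 + p ≡ 0ℤ × p ≡ 0ℤ
      b₄+p≡0 = nonneg-sum-zero (ℤ.+-mono-≤ 0≤b₄ 0≤p) 0≤p w₄≡0
      b₄≡0 : b v4 ≡ 0ℤ
      b₄≡0 = proj₁ (nonneg-sum-zero 0≤b₄ 0≤p (proj₁ b₄+p≡0))
      b₀≡-n : b v0 ≡ - n
      b₀≡-n = trans (sym ([x]₊-[-x]₊≡x (b v0))) (trans (cong (_- n) (proj₂ b₄+p≡0)) (ℤ.+-identityˡ (- n)))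
      b₀≤0 : b v0 ≤ 0ℤ
      b₀≤0 = subst (_≤ 0ℤ) (sym b₀≡-n) (ℤ.neg-mono-≤ (0≤[x]₊ (- b v0)))
      b₅-n-n≡0 : b v5 - n - n ≡ 0ℤ
      b₅-n-n≡0 = trans (sym B₃-v5) (trans w₅≡-w₄ (cong -_ (trans B₃-v4 w₄≡0)))
      b₅≡-2b₀ : b v5 ≡ - (+ 2 * b v0)
      b₅≡-2b₀ = begin
        b v5                            ≡⟨ regroup (b v5) n ⟩
        (b v5 - n - n) + - (+ 2 * - n)  ≡⟨ cong₂ (λ x y → x + - (+ 2 * y)) b₅-n-n≡0 (sym b₀≡-n) ⟩
        0ℤ + - (+ 2 * b v0)             ≡⟨ ℤ.+-identityˡ _ ⟩
        - (+ 2 * b v0)                  ∎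
        where regroup : ∀ x n → x ≡ (x - n - n) + - (+ 2 * - n)
              regroup = solve-∀

swap₁₃ : Fin 6 → Fin 6
swap₁₃ v1 = v3
swap₁₃ v2 = v4
swap₁₃ v3 = v1
swap₁₃ v4 = v2
swap₁₃ i  = i

admissible⇒PositiveX7Multiple : ∀ b → Admissible X6 b → PositiveX7Multiple b
admissible⇒PositiveX7Multiple b (nonzero , finite) = b₅≡-2b₀ , 0<b₅ , b₁≡0 , b₂≡0 , b₃≡0 , b₄≡0
  where
    N = proj₁ (finite⇒bounded finite)
    bounded : MutationBounded N (withFrozen X6 b)
    bounded = proj₂ (finite⇒bounded finite)
    pair₁₂ = frozen-kronecker-weights v1 v2 bounded refl refl
    pair₃₄ = frozen-kronecker-weights v3 v4 bounded refl refl
    pair₄₅ = frozen-kronecker-weights v4 v5 (MutationBounded-μs bounded (v0 ∷ v1 ∷ v2 ∷ [])) refl refl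
    pair₂₅ = frozen-kronecker-weights v2 v5 (MutationBounded-μs bounded (v0 ∷ v3 ∷ v4 ∷ [])) refl refl
    half₁ = FrozenColumn₀₁₂.v4⇒v5-constraint b (proj₁ pair₁₂) (proj₂ pair₁₂)
              (proj₂ pair₃₄) (proj₁ pair₄₅) (proj₂ pair₄₅)
    -- swap₁₃ is an automorphism of X₆, so μ₄μ₃μ₀ on b is μ₂μ₁μ₀ on b ∘ swap₁₃ by computation.
    half₂ = FrozenColumn₀₁₂.v4⇒v5-constraint (b ∘ swap₁₃) (proj₁ pair₃₄) (proj₂ pair₃₄)
              (proj₂ pair₁₂) (proj₁ pair₂₅) (proj₂ pair₂₅)
    b₄≡0    = proj₁ half₁
    b₅≡-2b₀ = proj₁ (proj₂ half₁)
    b₂≡0    = proj₁ half₂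
    b₁≡0    = x≡-y⇒x≡0⇒y≡0 (proj₁ pair₁₂) b₂≡0
    b₃≡0    = x≡-y⇒x≡0⇒y≡0 (proj₁ pair₃₄) b₄≡0
    b₀≢0 : b v0 ≢ 0ℤ
    b₀≢0 b₀≡0 = nonzero λ
      { v0 → b₀≡0 ; v1 → b₁≡0 ; v2 → b₂≡0 ; v3 → b₃≡0 ; v4 → b₄≡0
      ; v5 → trans b₅≡-2b₀ (cong (λ x → - (+ 2 * x)) b₀≡0) }
    0<b₅ = subst (0ℤ <_) (sym b₅≡-2b₀)
                 (ℤ.neg-mono-< (ℤ.*-monoˡ-<-pos (+ 2) (ℤ.≤∧≢⇒< (proj₂ (proj₂ half₁)) b₀≢0)))

-- Rescaling and relabelling

private
  neg-middle : ∀ x y z → - (x * y * z) ≡ x * - y * z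
  neg-middle = solve-∀

module _ {n : ℕ} where
  rescale : (Fin n → ℤ) → Mat n → Mat n
  rescale d A i j = d i * A i j * d j

  rescale-cong : ∀ d {A B : Mat n} → A ≐ B → rescale d A ≐ rescale d B
  rescale-cong d A≐B i j = cong (λ x → d i * x * d j) (A≐B i j)

  μ-rescale : ∀ {d} k (A : Mat n) → (∀ i → 0ℤ < d i) → d k ≡ 1ℤ →
              μ k (rescale d A) ≐ rescale d (μ k A)
  μ-rescale {d} k A d>0 dk≡1 i j with i ≟ k | j ≟ k
  ... | yes _ | _     = neg-middle (d i) (A i j) (d j)
  ... | no _  | yes _ = neg-middle (d i) (A i j) (d j)
  ... | no _  | no _  = begin
    d i * A i j * d j + sgn (d i * A i k * d k) * [ d i * A i k * d k * (d k * A k j * d j) ]₊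
      ≡⟨ cong₂ (λ s p → d i * A i j * d j + s * [ p ]₊) sign-of-path weight-of-path ⟩
    d i * A i j * d j + sgn (A i k) * [ (d i * d j) * (A i k * A k j) ]₊
      ≡⟨ cong (λ p → d i * A i j * d j + sgn (A i k) * p)
              ([d*x]₊≡d*[x]₊ (*-nonneg (ℤ.<⇒≤ (d>0 i)) (ℤ.<⇒≤ (d>0 j))) _) ⟩
    d i * A i j * d j + sgn (A i k) * ((d i * d j) * [ A i k * A k j ]₊)
      ≡⟨ distribute (d i) (A i j) (d j) (sgn (A i k)) _ ⟩
    d i * (A i j + sgn (A i k) * [ A i k * A k j ]₊) * d j ∎
    where
      open ≡-Reasoning
      regroup : ∀ x a b y → x * a * 1ℤ * (1ℤ * b * y) ≡ (x * y) * (a * b)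
      regroup = solve-∀
      distribute : ∀ x a y s p → x * a * y + s * ((x * y) * p) ≡ x * (a + s * p) * y
      distribute = solve-∀
      sign-of-path : sgn (d i * A i k * d k) ≡ sgn (A i k)
      sign-of-path = begin
        sgn (d i * A i k * d k)   ≡⟨ cong (λ e → sgn (d i * A i k * e)) dk≡1 ⟩
        sgn (d i * A i k * 1ℤ)    ≡⟨ cong sgn (ℤ.*-identityʳ _) ⟩
        sgn (d i * A i k)         ≡⟨ sgn[d*x]≡sgn[x] (d>0 i) (A i k) ⟩
        sgn (A i k)               ∎
      weight-of-path : d i * A i k * d k * (d k * A k j * d j) ≡ (d i * d j) * (A i k * A k j)
      weight-of-path = trans (cong (λ e → d i * A i k * e * (e * A k j * d j)) dk≡1)
                             (regroup (d i) (A i k) (A k j) (d j))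

  relabel : (Fin n → Fin n) → Mat n → Mat n
  relabel g A i j = A (g i) (g j)

  relabel-cong : ∀ g {A B : Mat n} → A ≐ B → relabel g A ≐ relabel g B
  relabel-cong g A≐B i j = A≐B (g i) (g j)

  μ-relabel : ∀ {g} → Injective _≡_ _≡_ g → ∀ k (A : Mat n) → μ k (relabel g A) ≐ relabel g (μ (g k) A)
  μ-relabel {g} g-inj k A i j with i ≟ k | j ≟ k | g i ≟ g k | g j ≟ g k
  ... | yes _   | _       | yes _     | _         = refl
  ... | yes i≡k | _       | no gi≢gk  | _         = ⊥-elim (gi≢gk (cong g i≡k))
  ... | no i≢k  | _       | yes gi≡gk | _         = ⊥-elim (i≢k (g-inj gi≡gk))
  ... | no _    | yes _   | no _      | yes _     = refl
  ... | no _    | yes j≡k | no _      | no gj≢gk  = ⊥-elim (gj≢gk (cong g j≡k))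
  ... | no _    | no j≢k  | no _      | yes gj≡gk = ⊥-elim (j≢k (g-inj gj≡gk))
  ... | no _    | no _    | no _      | no _      = refl

split-inject₁ : ∀ {m} (i : Fin m) → split (inject₁ i) ≡ just i
split-inject₁ {ℕ.suc m} zero    = refl
split-inject₁ {ℕ.suc m} (suc i) rewrite split-inject₁ i = refl

frozenWeight : ∀ {m} → ℤ → Fin (ℕ.suc m) → ℤ
frozenWeight K i with split i
... | just _  = 1ℤ
... | nothing = K

frozenWeight-inject₁ : ∀ {m} K (i : Fin m) → frozenWeight K (inject₁ i) ≡ 1ℤ
frozenWeight-inject₁ K i rewrite split-inject₁ i = refl

frozenWeight-pos : ∀ {m K} → 0ℤ < K → (i : Fin (ℕ.suc m)) → 0ℤ < frozenWeight K i
frozenWeight-pos 0<K i with split i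
... | just _  = +<+ (ℕ.s≤s ℕ.z≤n)
... | nothing = 0<K

frozenWeight∈ : ∀ {m} K (i : Fin (ℕ.suc m)) → frozenWeight K i ∈ 1ℤ ∷ K ∷ []
frozenWeight∈ K i with split i
... | just _  = here refl
... | nothing = there (here refl)

withFrozen-rescale : ∀ {m} (Q : Mat m) {b c : Fin m → ℤ} K → (∀ i → b i ≡ K * c i) →
                     withFrozen Q b ≐ rescale (frozenWeight K) (withFrozen Q c)
withFrozen-rescale Q {c = c} K b≡Kc i j with split i | split j
... | just i′ | just j′ = sym (unit-factors (Q i′ j′))
  where unit-factors : ∀ x → 1ℤ * x * 1ℤ ≡ x
        unit-factors = solve-∀
... | just i′ | nothing = trans (b≡Kc i′) (commute K (c i′))
  where commute : ∀ K x → K * x ≡ 1ℤ * x * K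
        commute = solve-∀
... | nothing | just j′ = trans (cong -_ (b≡Kc j′)) (commute K (c j′))
  where commute : ∀ K x → - (K * x) ≡ K * - x * 1ℤ
        commute = solve-∀
... | nothing | nothing = sym (trans (cong (_* K) (ℤ.*-zeroʳ K)) (ℤ.*-zeroˡ K))

allVecs : ∀ {A : Set} → List A → (n : ℕ) → List (Vec A n)
allVecs xs ℕ.zero    = [ [] ]
allVecs xs (ℕ.suc n) = cartesianProductWith _∷_ xs (allVecs xs n)

∈-allVecs : ∀ {A : Set} {xs : List A} {n} (v : Vec A n) → (∀ i → lookup v i ∈ xs) → v ∈ allVecs xs n
∈-allVecs []      _    = here refl
∈-allVecs (x ∷ v) v⊆xs = ∈-cartesianProductWith⁺ _∷_ (v⊆xs zero) (∈-allVecs v (v⊆xs ∘ suc))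

tabulate∈allVecs : ∀ {A : Set} {xs : List A} {n} (f : Fin n → A) → (∀ i → f i ∈ xs) →
                   tabulate f ∈ allVecs xs n
tabulate∈allVecs f f⊆xs =
  ∈-allVecs (tabulate f) (λ i → subst (_∈ _) (sym (lookup∘tabulate f i)) (f⊆xs i))

allMatrices : List ℤ → (n : ℕ) → List (Mat n)
allMatrices xs n = map (λ rows i j → lookup (lookup rows i) j) (allVecs (allVecs xs n) n)

allMatrices-complete : ∀ {xs n} (M : Mat n) → (∀ i j → M i j ∈ xs) → Any (M ≐_) (allMatrices xs n)
allMatrices-complete M M⊆xs =
  map⁺ (Any.map (λ rows≡ i j → trans (sym (lookup-tabulate² i j)) (cong (λ r → lookup (lookup r i) j) rows≡))
                (tabulate∈allVecs (tabulate ∘ M) (λ i → tabulate∈allVecs (M i) (M⊆xs i))))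
  where
    lookup-tabulate² : ∀ i j → lookup (lookup (tabulate (tabulate ∘ M)) i) j ≡ M i j
    lookup-tabulate² i j = trans (cong (λ r → lookup r j) (lookup∘tabulate _ i)) (lookup∘tabulate (M i) j)

entries∈⇒finite : ∀ {m} {B : Mat (ℕ.suc m)} (xs : List ℤ) →
                  (∀ ks i j → μs (map inject₁ ks) B i j ∈ xs) → FiniteMutationClass B
entries∈⇒finite xs entries∈ = allMatrices xs _ , λ ks → allMatrices-complete _ (entries∈ ks)

-- The mutation class of X₇

x7Weights : Fin 6 → ℤ
x7Weights v0 = -1ℤ
x7Weights v5 = + 2
x7Weights _  = 0ℤ

X7 : Mat 7
X7 = withFrozen X6 x7Weights

-- Up to relabelling, the only other matrix in the mutation class of X7.
X7′ : Mat 7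
X7′ i j = lookup (lookup rows i) j
  where
    rows : Vec (Vec ℤ 7) 7
    rows = ( 0ℤ ∷ -1ℤ ∷  1ℤ ∷ -1ℤ ∷  1ℤ ∷ -1ℤ ∷  1ℤ ∷ [])
         ∷ ( 1ℤ ∷  0ℤ ∷  1ℤ ∷  0ℤ ∷ -1ℤ ∷  0ℤ ∷ -1ℤ ∷ [])
         ∷ (-1ℤ ∷ -1ℤ ∷  0ℤ ∷  1ℤ ∷  0ℤ ∷  1ℤ ∷  0ℤ ∷ [])
         ∷ ( 1ℤ ∷  0ℤ ∷ -1ℤ ∷  0ℤ ∷  1ℤ ∷  0ℤ ∷ -1ℤ ∷ [])
         ∷ (-1ℤ ∷  1ℤ ∷  0ℤ ∷ -1ℤ ∷  0ℤ ∷  1ℤ ∷  0ℤ ∷ [])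
         ∷ ( 1ℤ ∷  0ℤ ∷ -1ℤ ∷  0ℤ ∷ -1ℤ ∷  0ℤ ∷  1ℤ ∷ [])
         ∷ (-1ℤ ∷  1ℤ ∷  0ℤ ∷  1ℤ ∷  0ℤ ∷ -1ℤ ∷  0ℤ ∷ [])
         ∷ []

X7-class : Fin 2 → Mat 7
X7-class zero       = X7
X7-class (suc zero) = X7′

X7-mutation : Fin 2 → Fin 7 → Fin 2 × Vec (Fin 7) 7
X7-mutation t k = lookup (lookup table t) k
  where
    table : Vec (Vec (Fin 2 × Vec (Fin 7) 7) 7) 2
    table = ((suc zero , # 0 ∷ # 1 ∷ # 2 ∷ # 3 ∷ # 4 ∷ # 5 ∷ # 6 ∷ [])
             ∷ (zero     , # 0 ∷ # 2 ∷ # 1 ∷ # 3 ∷ # 4 ∷ # 5 ∷ # 6 ∷ [])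
             ∷ (zero     , # 0 ∷ # 2 ∷ # 1 ∷ # 3 ∷ # 4 ∷ # 5 ∷ # 6 ∷ [])
             ∷ (zero     , # 0 ∷ # 1 ∷ # 2 ∷ # 4 ∷ # 3 ∷ # 5 ∷ # 6 ∷ [])
             ∷ (zero     , # 0 ∷ # 1 ∷ # 2 ∷ # 4 ∷ # 3 ∷ # 5 ∷ # 6 ∷ [])
             ∷ (zero     , # 0 ∷ # 1 ∷ # 2 ∷ # 3 ∷ # 4 ∷ # 6 ∷ # 5 ∷ [])
             ∷ (zero     , # 0 ∷ # 1 ∷ # 2 ∷ # 3 ∷ # 4 ∷ # 6 ∷ # 5 ∷ [])
             ∷ [])
          ∷ ((zero     , # 0 ∷ # 1 ∷ # 2 ∷ # 3 ∷ # 4 ∷ # 5 ∷ # 6 ∷ [])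
             ∷ (suc zero , # 1 ∷ # 2 ∷ # 0 ∷ # 4 ∷ # 5 ∷ # 6 ∷ # 3 ∷ [])
             ∷ (suc zero , # 2 ∷ # 0 ∷ # 1 ∷ # 4 ∷ # 5 ∷ # 6 ∷ # 3 ∷ [])
             ∷ (suc zero , # 1 ∷ # 4 ∷ # 5 ∷ # 2 ∷ # 0 ∷ # 6 ∷ # 3 ∷ [])
             ∷ (suc zero , # 2 ∷ # 4 ∷ # 5 ∷ # 0 ∷ # 1 ∷ # 6 ∷ # 3 ∷ [])
             ∷ (suc zero , # 1 ∷ # 4 ∷ # 5 ∷ # 6 ∷ # 3 ∷ # 2 ∷ # 0 ∷ [])
             ∷ (suc zero , # 2 ∷ # 4 ∷ # 5 ∷ # 6 ∷ # 3 ∷ # 0 ∷ # 1 ∷ [])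
             ∷ [])
          ∷ []

X7-relabelling : Fin 2 → Fin 7 → Fin 7 → Fin 7
X7-relabelling t k = lookup (proj₂ (X7-mutation t k))

X7-class-closed : ∀ t k →
                  μ k (X7-class t) ≐ relabel (X7-relabelling t k) (X7-class (proj₁ (X7-mutation t k)))
X7-class-closed = from-yes (all? λ t → all? λ k → all? λ i → all? λ j →
  μ k (X7-class t) i j ℤ.≟ relabel (X7-relabelling t k) (X7-class (proj₁ (X7-mutation t k))) i j)

X7-relabelling-injective : ∀ t k → Injective _≡_ _≡_ (X7-relabelling t k)
X7-relabelling-injective t k {i} {j} = from-yes (all? λ t → all? λ k → all? λ i → all? λ j →
  (X7-relabelling t k i ≟ X7-relabelling t k j) →-dec (i ≟ j)) t k i j

X7-entries : List ℤ
X7-entries = -[1+ 1 ] ∷ -1ℤ ∷ 0ℤ ∷ 1ℤ ∷ + 2 ∷ []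

X7-class-entries : ∀ t i j → X7-class t i j ∈ X7-entries
X7-class-entries = from-yes (all? λ t → all? λ i → all? λ j → X7-class t i j ∈? X7-entries)

record ScaledX7 (K : ℤ) (B : Mat 7) : Set where
  field
    relabelling : Fin 7 → Fin 7
    injective   : Injective _≡_ _≡_ relabelling
    member      : Fin 2
    matches     : B ≐ rescale (frozenWeight K) (relabel relabelling (X7-class member))

ScaledX7-μ : ∀ {K B} → 0ℤ < K → ScaledX7 K B → (k : Fin 6) → ScaledX7 K (μ (inject₁ k) B)
ScaledX7-μ {K} 0<K S k = record
  { relabelling = X7-relabelling member k′ ∘ relabelling
  ; injective   = injective ∘ X7-relabelling-injective member k′
  ; member      = proj₁ (X7-mutation member k′)
  ; matches     =
      ≐-trans (μ-cong (inject₁ k) matches)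
      (≐-trans (μ-rescale (inject₁ k) _ (frozenWeight-pos 0<K) (frozenWeight-inject₁ K k))
               (rescale-cong (frozenWeight K)
                 (≐-trans (μ-relabel injective (inject₁ k) _)
                          (relabel-cong relabelling (X7-class-closed member k′)))))
  }
  where
    open ScaledX7 S
    k′ = relabelling (inject₁ k)

ScaledX7-μs : ∀ {K B} → 0ℤ < K → ScaledX7 K B → ∀ ks → ScaledX7 K (μs (map inject₁ ks) B)
ScaledX7-μs 0<K S []       = S
ScaledX7-μs 0<K S (k ∷ ks) = ScaledX7-μs 0<K (ScaledX7-μ 0<K S k) ks

scaledX7-entries : ℤ → List ℤ
scaledX7-entries K = cartesianProductWith _*_ (cartesianProductWith _*_ weights X7-entries) weights
  where weights = 1ℤ ∷ K ∷ []

ScaledX7-entries : ∀ {K B} → ScaledX7 K B → ∀ i j → B i j ∈ scaledX7-entries K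
ScaledX7-entries {K} S i j = subst (_∈ _) (sym (matches i j))
  (∈-cartesianProductWith⁺ _*_
    (∈-cartesianProductWith⁺ _*_ (frozenWeight∈ K i) (X7-class-entries member _ _))
    (frozenWeight∈ K j))
  where open ScaledX7 S

PositiveX7Multiple⇒admissible : ∀ b → PositiveX7Multiple b → Admissible X6 b
PositiveX7Multiple⇒admissible b (b₅≡-2b₀ , 0<b₅ , b₁≡0 , b₂≡0 , b₃≡0 , b₄≡0) = nonzero , finite
  where
    K : ℤ
    K = - b v0
    0<K : 0ℤ < K
    0<K = ℤ.*-cancelˡ-<-nonNeg (+ 2)
            (subst (0ℤ <_) (trans b₅≡-2b₀ (ℤ.neg-distribʳ-* (+ 2) (b v0))) 0<b₅)
    b≡Kx7 : ∀ i → b i ≡ K * x7Weights i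
    b≡Kx7 v0 = neg-neg (b v0)
      where neg-neg : ∀ x → x ≡ - x * -1ℤ
            neg-neg = solve-∀
    b≡Kx7 v1 = trans b₁≡0 (sym (ℤ.*-zeroʳ K))
    b≡Kx7 v2 = trans b₂≡0 (sym (ℤ.*-zeroʳ K))
    b≡Kx7 v3 = trans b₃≡0 (sym (ℤ.*-zeroʳ K))
    b≡Kx7 v4 = trans b₄≡0 (sym (ℤ.*-zeroʳ K))
    b≡Kx7 v5 = trans b₅≡-2b₀ (commute (b v0))
      where commute : ∀ x → - (+ 2 * x) ≡ - x * + 2
            commute = solve-∀
    start : ScaledX7 K (withFrozen X6 b)
    start = record { relabelling = id ; injective = id ; member = zero ; matches = withFrozen-rescale X6 K b≡Kx7 }
    finite : FiniteMutationClass (withFrozen X6 b)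
    finite = entries∈⇒finite (scaledX7-entries K) (λ ks → ScaledX7-entries (ScaledX7-μs 0<K start ks))
    nonzero : ¬ (∀ i → b i ≡ 0ℤ)
    nonzero all-zero = ℤ.<-irrefl (sym (all-zero v5)) 0<b₅

theorem6p2 : (b : Fin 6 → ℤ) →
    Admissible X6 b ⇔
      ((b v5 ≡ - (+ 2 * b v0)) × (0ℤ < b v5) ×
       (b v1 ≡ 0ℤ) × (b v2 ≡ 0ℤ) × (b v3 ≡ 0ℤ) × (b v4 ≡ 0ℤ))
theorem6p2 b = mk⇔ (admissible⇒PositiveX7Multiple b) (PositiveX7Multiple⇒admissible b)
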